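{- Let $T$ be a threshold graph with threshold ordering $v_1,\dots,v_n$. Let $c_1,\dots,c_m$ be the vertices on the dominating side listed in order, with $c_r=v_{t_r}$; let $P_r=\{v_1,\dots,v_{t_r-1}\}$; let $I$ be the set of vertices on the isolated side; and let $I_r=\{v_j\in I: j>t_r\}$. Then every dominating set $S$ of $T$ containing at least one vertex on the dominating side has a unique index $r$ such that $c_r$ is the last vertex (in the ordering) on the dominating side lying in $S$, and for this $r$ one has $S=U\cup\{c_r\}\cup I_r$ for some subset $U\subseteq P_r$; conversely, every set of the form $U\cup\{c_r\}\cup I_r$ with $U\subseteq P_r$ is dominating. Moreover, a dominating set of $T$ containing no vertex on the dominating side exists if and only if some vertex on the isolated side precedes $c_1$ in the ordering, and in that case the only such dominating set is $I$.
   Context: A set $S\subseteq V(G)$ is dominating if every vertex is in $S$ or adjacent to a vertex of $S$. A graph $T$ on $n$ vertices is a threshold graph if there is an ordering $v_1,\dots,v_n$ of its vertices (a threshold ordering) such that each $v_j$ is either isolated or adjacent to all of $v_1,\dots,v_{j-1}$ in the induced subgraph on $\{v_1,\dots,v_j\}$. Vertices added as adjacent to all earlier vertices are said to be on the dominating side; vertices added as isolated are on the isolated side. (If there are no vertices on the dominating side, $m=0$.) -}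

module Defs where

open import Data.Nat using (ℕ)
open import Data.Bool using (Bool; true; false; if_then_else_)
open import Data.Fin using (Fin; _<_; _>_; _<?_)
open import Data.Fin.Subset using (Subset; _∈_; _∉_)
open import Data.Vec using (tabulate)
open import Data.Product using (Σ; ∃; _×_)
open import Data.Sum using (_⊎_)
open import Relation.Nullary using (¬_; does)
open import Relation.Binary.PropositionalEquality using (_≡_)

record SimpleGraph (n : ℕ) : Set₁ where
  field
    Adj   : Fin n → Fin n → Set
    sym   : ∀ {u v} → Adj u v → Adj v u
    irrfl : ∀ {v} → ¬ Adj v v
open SimpleGraph public

-- The vertices are labelled Fin n in the order v_1,...,v_n (v_{j+1} = j).
-- side j ≡ true : v_j is on the dominating side; false : isolated side.
IsThresholdOrdering : ∀ {n} → SimpleGraph n → (Fin n → Bool) → Set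
IsThresholdOrdering G side =
  ∀ j → (side j ≡ true → ∀ i → i < j → Adj G i j)
      × (side j ≡ false → ∀ i → i < j → ¬ Adj G i j)

Dominating : ∀ {n} → SimpleGraph n → Subset n → Set
Dominating G S = ∀ v → v ∈ S ⊎ ∃ λ u → u ∈ S × Adj G u v

LastDomIn : ∀ {n} → (Fin n → Bool) → Subset n → Fin n → Set
LastDomIn side S c =
  side c ≡ true × c ∈ S × (∀ j → c < j → side j ≡ true → j ∉ S)

NoDomIn : ∀ {n} → (Fin n → Bool) → Subset n → Set
NoDomIn side S = ∀ j → side j ≡ true → j ∉ S

Before : ∀ {n} → Fin n → Subset n
Before c = tabulate λ i → does (i <? c)

Iso : ∀ {n} → (Fin n → Bool) → Subset n
Iso side = tabulate λ j → if side j then false else true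

IsoAfter : ∀ {n} → (Fin n → Bool) → Fin n → Subset n
IsoAfter side c = tabulate λ j → if side j then false else does (c <? j)

{-# OPTIONS --safe #-}
-- In a threshold graph the neighbours of an isolated-side vertex x are exactly the
-- dominating-side vertices after x.  So if c is the last dominating-side vertex of a
-- dominating set S, no vertex of S can dominate an isolated-side vertex after c, which
-- must therefore lie in S; conversely c alone dominates every earlier vertex and every
-- later dominating-side vertex.  If S has no dominating-side vertex at all, the same
-- argument forces S = I, and I dominates c₁ only if some isolated-side vertex precedes it.
module Submission where

open import Defs
open import Data.Nat using (ℕ; _≤_; z<s; s<s)
import Data.Nat as ℕ
open import Data.Bool using (Bool; true; false; if_then_else_; _≟_)
open import Data.Bool.Properties using (¬-not)
open import Data.Fin using (Fin; _<_; _<?_; zero; suc)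
open import Data.Fin.Properties using (<-cmp; <-trans)
open import Data.Fin.Subset using (Subset; _∈_; _∉_; _⊆_; _∪_; _∩_; ⁅_⁆)
open import Data.Fin.Subset.Properties
  using (x∈p∪q⁻; x∈p∪q⁺; x∈p∩q⁺; x∈p∩q⁻; p∩q⊆q; x∈⁅x⁆; x∈⁅y⁆⇒x≡y; ⊆-antisym; _∈?_)
open import Data.Product using (Σ; ∃; _×_; _,_; proj₁; proj₂; uncurry)
open import Data.Sum using (_⊎_; inj₁; inj₂)
import Data.Sum as Sum
open import Data.Vec using (tabulate)
open import Data.Vec.Properties using (lookup∘tabulate; []=⇒lookup; lookup⇒[]=)
open import Function using (_∘_)
open import Function.Bundles using (_⇔_; mk⇔)
open import Relation.Nullary using (¬_; Dec; does; yes; no; contradiction)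
open import Relation.Nullary.Decidable using (dec-true; _×-dec_)
open import Relation.Unary using (Decidable)
open import Relation.Binary using (tri<; tri≈; tri>)
open import Relation.Binary.PropositionalEquality using (_≡_; refl; trans; cong)
  renaming (sym to ≡-sym)

dec-true⁻ : ∀ {a} {A : Set a} (a? : Dec A) → does a? ≡ true → A
dec-true⁻ (yes a) _ = a

none-or-last : ∀ {n p} {P : Fin n → Set p} → Decidable P →
               (∀ i → ¬ P i) ⊎ ∃ λ i → P i × (∀ j → i < j → ¬ P j)
none-or-last {ℕ.zero} P? = inj₁ λ ()
none-or-last {ℕ.suc n} P? with none-or-last (P? ∘ suc) | P? zero
... | inj₂ (i , Pi , last) | _     = inj₂ (suc i , Pi , λ { (suc j) (s<s i<j) → last j i<j })
... | inj₁ none            | yes P0 = inj₂ (zero , P0 , λ { (suc j) _ → none j })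
... | inj₁ none            | no ¬P0 = inj₁ λ { zero → ¬P0 ; (suc j) → none j }

∈-tabulate⁺ : ∀ {n} {f : Fin n → Bool} {x} → f x ≡ true → x ∈ tabulate f
∈-tabulate⁺ {f = f} {x} fx = lookup⇒[]= x _ (trans (lookup∘tabulate f x) fx)

∈-tabulate⁻ : ∀ {n} {f : Fin n → Bool} {x} → x ∈ tabulate f → f x ≡ true
∈-tabulate⁻ {f = f} {x} x∈ = trans (≡-sym (lookup∘tabulate f x)) ([]=⇒lookup x∈)

∈-Before⁺ : ∀ {n} {r x : Fin n} → x < r → x ∈ Before r
∈-Before⁺ {r = r} {x} x<r = ∈-tabulate⁺ (dec-true (x <? r) x<r)

module _ {n} {side : Fin n → Bool} where

  ∈-Iso⁺ : ∀ {x : Fin n} → side x ≡ false → x ∈ Iso side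
  ∈-Iso⁺ sx = ∈-tabulate⁺ (cong (if_then false else true) sx)

  ∈-Iso⁻ : ∀ {x} → x ∈ Iso side → side x ≡ false
  ∈-Iso⁻ {x} x∈ with side x | ∈-tabulate⁻ x∈
  ... | false | _  = refl
  ... | true  | ()

  NoDomIn-Iso : NoDomIn side (Iso side)
  NoDomIn-Iso j sj j∈I = contradiction (trans (≡-sym sj) (∈-Iso⁻ j∈I)) λ ()

  ∈-IsoAfter⁺ : ∀ {r x : Fin n} → side x ≡ false → r < x → x ∈ IsoAfter side r
  ∈-IsoAfter⁺ {r} {x} sx r<x =
    ∈-tabulate⁺ (trans (cong (if_then false else does (r <? x)) sx) (dec-true (r <? x) r<x))

  ∈-IsoAfter⁻ : ∀ {r x : Fin n} → x ∈ IsoAfter side r → side x ≡ false × r < x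
  ∈-IsoAfter⁻ {r} {x} x∈ with side x | ∈-tabulate⁻ x∈
  ... | false | r<?x = refl , dec-true⁻ (r <? x) r<?x
  ... | true  | ()

  ∈-canonical⁺ : ∀ {U r x} → x ∈ U ⊎ x ≡ r ⊎ (side x ≡ false × r < x) →
                 x ∈ U ∪ ⁅ r ⁆ ∪ IsoAfter side r
  ∈-canonical⁺ (inj₁ x∈U)               = x∈p∪q⁺ (inj₁ x∈U)
  ∈-canonical⁺ (inj₂ (inj₁ refl))       = x∈p∪q⁺ (inj₂ (x∈p∪q⁺ (inj₁ (x∈⁅x⁆ _))))
  ∈-canonical⁺ (inj₂ (inj₂ (sx , r<x))) = x∈p∪q⁺ (inj₂ (x∈p∪q⁺ (inj₂ (∈-IsoAfter⁺ sx r<x))))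

  ∈-canonical⁻ : ∀ {U r x} → x ∈ U ∪ ⁅ r ⁆ ∪ IsoAfter side r →
                 x ∈ U ⊎ x ≡ r ⊎ (side x ≡ false × r < x)
  ∈-canonical⁻ {U} {r} =
    Sum.map₂ (Sum.map (x∈⁅y⁆⇒x≡y r) ∈-IsoAfter⁻ ∘ x∈p∪q⁻ _ _) ∘ x∈p∪q⁻ U _

module _ {n} {side : Fin n → Bool} {S : Subset n} where

  LastDomIn-exists : (∃ λ c → side c ≡ true × c ∈ S) → ∃ (LastDomIn side S)
  LastDomIn-exists (c , sc , c∈S)
    with none-or-last (λ j → (side j ≟ true) ×-dec (j ∈? S))
  ... | inj₁ none = contradiction (sc , c∈S) (none c)
  ... | inj₂ (r , (sr , r∈S) , last) = r , sr , r∈S , λ j r<j sj j∈S → last j r<j (sj , j∈S)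

  LastDomIn-unique : ∀ {r r′} → LastDomIn side S r → LastDomIn side S r′ → r ≡ r′
  LastDomIn-unique {r} {r′} (sr , r∈S , last) (sr′ , r′∈S , last′) with <-cmp r r′
  ... | tri< r<r′ _ _ = contradiction r′∈S (last r′ r<r′ sr′)
  ... | tri≈ _ r≡r′ _ = r≡r′
  ... | tri> _ _ r′<r = contradiction r∈S (last′ r r′<r sr)

module ThresholdDomination {n} (G : SimpleGraph n) (side : Fin n → Bool)
                           (threshold : IsThresholdOrdering G side) where

  adj-dominating-side : ∀ {i j} → side j ≡ true → i < j → Adj G i j
  adj-dominating-side {i} {j} sj i<j = proj₁ (threshold j) sj i i<j

  ¬adj-isolated-side : ∀ {i j} → side j ≡ false → i < j → ¬ Adj G i j
  ¬adj-isolated-side {i} {j} sj i<j = proj₂ (threshold j) sj i i<j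

  neighbour-of-isolated : ∀ {u x} → side x ≡ false → Adj G u x → x < u × side u ≡ true
  neighbour-of-isolated {u} {x} sx u~x with <-cmp u x
  ... | tri< u<x _ _  = contradiction u~x (¬adj-isolated-side sx u<x)
  ... | tri≈ _ refl _ = contradiction u~x (irrfl G)
  ... | tri> _ _ x<u with side u in su
  ...   | true  = x<u , refl
  ...   | false = contradiction (sym G u~x) (¬adj-isolated-side su x<u)

  isolated-∈-dominating : ∀ {S x} → Dominating G S → side x ≡ false →
                          (∀ u → x < u → side u ≡ true → u ∉ S) → x ∈ S
  isolated-∈-dominating {x = x} dom sx later with dom x
  ... | inj₁ x∈S             = x∈S
  ... | inj₂ (u , u∈S , u~x) = contradiction u∈S (uncurry (later u) (neighbour-of-isolated sx u~x))

  canonical-dominating : ∀ {r} → side r ≡ true → ∀ U → Dominating G (U ∪ ⁅ r ⁆ ∪ IsoAfter side r)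
  canonical-dominating {r} sr U v with <-cmp v r
  ... | tri< v<r _ _  = inj₂ (r , ∈-canonical⁺ (inj₂ (inj₁ refl)) , sym G (adj-dominating-side sr v<r))
  ... | tri≈ _ refl _ = inj₁ (∈-canonical⁺ (inj₂ (inj₁ refl)))
  ... | tri> _ _ r<v with side v in sv
  ...   | true  = inj₂ (r , ∈-canonical⁺ (inj₂ (inj₁ refl)) , adj-dominating-side sv r<v)
  ...   | false = inj₁ (∈-canonical⁺ (inj₂ (inj₂ (sv , r<v))))

  dominating-decomposition : ∀ {S r} → Dominating G S → LastDomIn side S r →
                             S ≡ (S ∩ Before r) ∪ ⁅ r ⁆ ∪ IsoAfter side r
  dominating-decomposition {S} {r} dom (sr , r∈S , last) = ⊆-antisym ⊆canonical canonical⊆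
    where
    ⊆canonical : S ⊆ (S ∩ Before r) ∪ ⁅ r ⁆ ∪ IsoAfter side r
    ⊆canonical {x} x∈S with <-cmp x r
    ... | tri< x<r _ _ = ∈-canonical⁺ (inj₁ (x∈p∩q⁺ (x∈S , ∈-Before⁺ x<r)))
    ... | tri≈ _ x≡r _ = ∈-canonical⁺ (inj₂ (inj₁ x≡r))
    ... | tri> _ _ r<x with side x in sx
    ...   | true  = contradiction x∈S (last x r<x sx)
    ...   | false = ∈-canonical⁺ (inj₂ (inj₂ (sx , r<x)))
    canonical⊆ : (S ∩ Before r) ∪ ⁅ r ⁆ ∪ IsoAfter side r ⊆ S
    canonical⊆ x∈ with ∈-canonical⁻ x∈
    ... | inj₁ x∈U               = proj₁ (x∈p∩q⁻ S _ x∈U)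
    ... | inj₂ (inj₁ refl)       = r∈S
    ... | inj₂ (inj₂ (sx , r<x)) =
      isolated-∈-dominating dom sx λ u x<u → last u (<-trans r<x x<u)

  NoDomIn-dominating≡Iso : ∀ {S} → Dominating G S → NoDomIn side S → S ≡ Iso side
  NoDomIn-dominating≡Iso dom none = ⊆-antisym
    (λ {x} x∈S → ∈-Iso⁺ (¬-not λ sx → none x sx x∈S))
    (λ x∈I → isolated-∈-dominating dom (∈-Iso⁻ x∈I) λ u _ → none u)

  NoDomIn-dominator-precedes : ∀ {S v} → Dominating G S → NoDomIn side S → side v ≡ true →
                               ∃ λ u → u ∈ S × u < v
  NoDomIn-dominator-precedes {v = v} dom none sv with dom v
  ... | inj₁ v∈S             = contradiction v∈S (none v sv)
  ... | inj₂ (u , u∈S , u~v) =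
    u , u∈S , proj₁ (neighbour-of-isolated (¬-not λ su → none u su u∈S) (sym G u~v))

  Iso-dominating : ∀ {i} → side i ≡ false → (∀ j → side j ≡ true → i < j) → Dominating G (Iso side)
  Iso-dominating {i} si i<dom v with side v in sv
  ... | true  = inj₂ (i , ∈-Iso⁺ si , adj-dominating-side sv (i<dom v sv))
  ... | false = inj₁ (∈-Iso⁺ sv)

NoDomIn-dominating⇔isolated-first :
  ∀ {n} → 1 ≤ n → (G : SimpleGraph n) (side : Fin n → Bool) → IsThresholdOrdering G side →
  (∃ λ S → Dominating G S × NoDomIn side S) ⇔ (∃ λ i → side i ≡ false × (∀ j → side j ≡ true → i < j))
NoDomIn-dominating⇔isolated-first {ℕ.suc _} _ G side threshold =
  mk⇔ first-vertex-isolated λ (i , si , i<dom) → Iso side , Iso-dominating si i<dom , NoDomIn-Iso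
  where
  open ThresholdDomination G side threshold
  first-vertex-isolated : (∃ λ S → Dominating G S × NoDomIn side S) →
                          ∃ λ i → side i ≡ false × (∀ j → side j ≡ true → i < j)
  first-vertex-isolated (S , dom , none) with side zero in s0
  ... | true  = contradiction (proj₂ (proj₂ (NoDomIn-dominator-precedes dom none s0))) λ ()
  ... | false = zero , s0 , λ { zero sj → contradiction (trans (≡-sym s0) sj) λ () ; (suc _) _ → z<s }

lemma17 : (n : ℕ) → 1 ≤ n → (G : SimpleGraph n) → (side : Fin n → Bool) →
    IsThresholdOrdering G side →
    (∀ S → Dominating G S → (∃ λ c → side c ≡ true × c ∈ S) →
      Σ (Fin n) λ r → (LastDomIn side S r × (∀ r′ → LastDomIn side S r′ → r′ ≡ r))
        × ∃ λ U → U ⊆ Before r × S ≡ U ∪ ⁅ r ⁆ ∪ IsoAfter side r)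
    × (∀ r → side r ≡ true → ∀ U → U ⊆ Before r →
        Dominating G (U ∪ ⁅ r ⁆ ∪ IsoAfter side r))
    × ((∃ λ S → Dominating G S × NoDomIn side S)
        ⇔ (∃ λ i → side i ≡ false × (∀ j → side j ≡ true → i < j)))
    × (∀ S → Dominating G S → NoDomIn side S → S ≡ Iso side)
lemma17 n 1≤n G side threshold =
    (λ S dom hasDom →
      let r , last = LastDomIn-exists hasDom
      in r , (last , λ _ last′ → LastDomIn-unique last′ last)
           , S ∩ Before r , p∩q⊆q S (Before r) , dominating-decomposition dom last)
  , (λ r sr U _ → canonical-dominating sr U)
  , NoDomIn-dominating⇔isolated-first 1≤n G side threshold
  , (λ S → NoDomIn-dominating≡Iso)
  where open ThresholdDomination G side threshold
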